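{- Let $f(z),h(z)$ be transitions in parallel, and let $\mathcal{M}_{\mathrm{BLin}}$ be the bilinear infinite counting automaton with states $\mathbb{Z}$, initial state $0$, final states $\{0\}$, a loop labelled $h(z)$ at every state, and transitions labelled $f(z)$ from $i$ to $i+1$ and from $i+1$ to $i$ for every $i\in\mathbb{Z}$. Then its generating function is $$B_b(z)=\frac{1}{1-h(z)}+\sum_{n=1}^{\infty}\sum_{k=0}^{\infty}\sum_{l=0}^{\infty}2^n\frac{n}{n+2k}\binom{n+2k}{k}\binom{l+2n+2k}{l}f(z)^{2n+2k}h(z)^{l}.$$
   Context: A transition in parallel labelled $f(z)=\sum_{n\ge1}f_nz^n$ ($f_n\in\mathbb{N}$, zero constant term) from state $p$ to state $q$ stands for: for each $n\ge1$, $f_n$ disjoint chains of $n$ transitions labelled $z$ from $p$ to $q$ through $n-1$ new hidden non-final states, from each of which only the next transition of the chain starts. The generating function of a counting automaton is $\sum_n a_nz^n$ with $a_n$ the number of paths of $n$ transitions (all transitions in parallel expanded) from the initial state to a final state. -}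

module Defs where

open import Data.Nat using (ℕ; zero; suc; _+_; _*_; _∸_; _^_)
open import Data.Nat.DivMod using (_/_)
open import Data.Nat.Combinatorics using (_C_)
open import Data.Integer using (ℤ; 1ℤ) renaming (_+_ to _+ℤ_)
open import Data.Fin using (Fin; zero; suc; inject₁; fromℕ)
open import Relation.Binary.PropositionalEquality using (_≡_)

-- Formal power series with natural-number coefficients: n ↦ [z^n]
Series : Set
Series = ℕ → ℕ

-- a "transition in parallel": coefficients in ℕ and zero constant term
ZeroConst : Series → Set
ZeroConst f = f 0 ≡ 0

sumTo : ℕ → (ℕ → ℕ) → ℕ
sumTo zero    g = g 0
sumTo (suc N) g = sumTo N g + g (suc N)

one : Series
one zero    = 1
one (suc _) = 0

_⊛_ : Series → Series → Series
(f ⊛ g) N = sumTo N (λ i → f i * g (N ∸ i))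

pow : Series → ℕ → Series
pow f zero    = one
pow f (suc k) = f ⊛ pow f k

-- The bilinear counting automaton, with all transitions in parallel
-- expanded into chains through hidden states.

module BLin (f h : Series) where

  data Edge : Set where
    loop : ℤ → Edge
    up   : ℤ → Edge
    down : ℤ → Edge

  src : Edge → ℤ
  src (loop i) = i
  src (up i)   = i
  src (down i) = i +ℤ 1ℤ

  tgt : Edge → ℤ
  tgt (loop i) = i
  tgt (up i)   = i +ℤ 1ℤ
  tgt (down i) = i

  lab : Edge → Series
  lab (loop _) = h
  lab (up _)   = f
  lab (down _) = f

  -- States of the expanded automaton: original states, and hidden states
  -- hid e m c i = the (i+1)-th intermediate state of the c-th chain of
  -- length (suc m) replacing transition e  (chain has m hidden states).
  data State : Set where
    main : ℤ → State
    hid  : (e : Edge) (m : ℕ) → Fin (lab e (suc m)) → Fin m → State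

  -- Transitions of the expanded automaton (a multigraph: each inhabitant
  -- is one transition labelled z).
  data Step : State → State → Set where
    direct : (e : Edge) (c : Fin (lab e 1)) →
             Step (main (src e)) (main (tgt e))
    enter  : (e : Edge) (m : ℕ) (c : Fin (lab e (suc (suc m)))) →
             Step (main (src e)) (hid e (suc m) c zero)
    next   : (e : Edge) (m : ℕ) (c : Fin (lab e (suc (suc m)))) (i : Fin m) →
             Step (hid e (suc m) c (inject₁ i)) (hid e (suc m) c (suc i))
    exit   : (e : Edge) (m : ℕ) (c : Fin (lab e (suc (suc m)))) →
             Step (hid e (suc m) c (fromℕ m)) (main (tgt e))

  data Path : ℕ → State → State → Set where
    []  : ∀ {s} → Path 0 s s
    _∷_ : ∀ {n s t u} → Step s t → Path n t u → Path (suc n) s u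

  Accepted : ℕ → Set
  Accepted n = Path n (main (ℤ.pos 0)) (main (ℤ.pos 0))

-- 2^n * n/(n+2k) * C(n+2k, k) for n = suc n' ≥ 1 (an integer)
weight : ℕ → ℕ → ℕ
weight n' k = 2 ^ suc n' * ((suc n' * ((suc n' + 2 * k) C k)) / (suc n' + 2 * k))

-- [z^N] of 1/(1-h) = Σ_l h^l   (terms with l > N vanish since h 0 = 0)
geomCoef : Series → ℕ → ℕ
geomCoef h N = sumTo N (λ l → pow h l N)

-- [z^N] of Σ_{n≥1,k≥0,l≥0} weight * C(l+2n+2k, l) f^{2n+2k} h^l
-- (terms with n > N, k > N or l > N vanish since f 0 = h 0 = 0)
tripleCoef : Series → Series → ℕ → ℕ
tripleCoef f h N =
  sumTo N λ n' → sumTo N λ k → sumTo N λ l →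
    weight n' k * ((l + 2 * suc n' + 2 * k) C l)
      * (pow f (2 * suc n' + 2 * k) ⊛ pow h l) N

Bb : Series → Series → Series
Bb f h N = geomCoef h N + tripleCoef f h N

-- Expanding the chains, an accepted path is a closed walk on ℤ made of loops and ±1 steps,
-- each step taken as one of the chains of its label. Such a walk is determined by the number
-- m of up-steps (= down-steps), the number l of loops, the positions of the loops among the
-- l + 2m steps, the choice of the m up-steps among the 2m others, and the two sequences of
-- chains; so there are Σ_{m,l} C(2m,m) C(l+2m,l) [z^N] f^{2m} h^l walks of length N. The
-- right-hand side takes this shape once its terms are grouped by m = n + k: the weights
-- 2^n n/(n+2k) C(n+2k,k) with n + k = m, n ≥ 1, telescope to C(2m,m), since n/(n+2k) C(n+2k,k)
-- is the difference C(n+2k,k) - 2 C(n+2k-1,k-1) of binomials; and 1/(1 - h) is the layer m = 0.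

module Submission where

open import Defs
open import Data.Nat using (ℕ; zero; suc; _+_; _*_; _∸_; _^_; _≤_; z≤n; s≤s; s≤s⁻¹; _≟_)
open import Data.Nat.Properties
open import Data.Nat.DivMod using (_/_; m*n/n≡m)
open import Data.Nat.Combinatorics using (_C_; nC1≡n; nCn≡1; nCk≡nC[n∸k]; nCk+nC[k+1]≡[n+1]C[k+1])
open import Data.Nat.Tactic.RingSolver using (solve-∀)
open import Algebra.Properties.CommutativeSemigroup +-commutativeSemigroup using (x∙yz≈y∙xz)
open import Data.Integer using (ℤ; 1ℤ; -1ℤ) renaming (_+_ to _+ℤ_)
import Data.Integer.Properties as ℤₚ
open import Data.Integer.Tactic.RingSolver using () renaming (solve-∀ to ℤ-solve-∀)
open import Data.Fin using (Fin; zero; suc; toℕ; fromℕ; inject₁)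
open import Data.Fin.Properties using (+↔⊎; *↔×; ¬Fin0; toℕ-fromℕ; toℕ-inject₁; toℕ<n)
open import Data.Fin.Relation.Unary.Top using (View; ‵fromℕ; ‵inj₁; view; view-fromℕ; view-inject₁)
open import Data.Vec using (Vec; []; _∷_)
open import Data.Product using (Σ; Σ-syntax; _×_; _,_; proj₁; proj₂)
open import Data.Product.Function.NonDependent.Propositional using (_×-↔_)
import Data.Product.Function.Dependent.Propositional as Σ
open import Data.Sum using (_⊎_; inj₁; inj₂)
open import Data.Sum.Function.Propositional using (_⊎-↔_)
open import Data.Empty using (⊥-elim)
open import Function.Bundles using (_↔_; mk↔ₛ′; Inverse)
open import Function.Properties.Inverse using (↔-refl; ↔-sym; ↔-trans)
open import Function.Related.Propositional using (module EquationalReasoning; K-reflexive)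
open import Function.Related.TypeIsomorphisms using (Σ-assoc; ×-comm)
open import Axiom.UniquenessOfIdentityProofs using (module Decidable⇒UIP)
open import Relation.Nullary using (yes; no)
open import Relation.Binary.PropositionalEquality

private variable a b k l n : ℕ

-- Counting graded sets

Fibre : {X : Set} → (X → ℕ) → ℕ → Set
Fibre {X} s n = Σ[ x ∈ X ] s x ≡ n

fibre-↔ : {X Y : Set} {s : X → ℕ} {t : Y → ℕ} (φ : X ↔ Y) →
          (∀ x → t (Inverse.to φ x) ≡ s x) → ∀ {n} → Fibre s n ↔ Fibre t n
fibre-↔ φ t∘φ≡s = Σ.cong φ λ {x} → mk↔ₛ′ (trans (t∘φ≡s x)) (trans (sym (t∘φ≡s x)))
  (λ _ → ≡-irrelevant _ _) (λ _ → ≡-irrelevant _ _)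

Σ≤ : ℕ → (ℕ → Set) → Set
Σ≤ N P = Σ[ i ∈ ℕ ] i ≤ N × P i

Σ≤-zero : {P : ℕ → Set} → Σ≤ 0 P ↔ P 0
Σ≤-zero = mk↔ₛ′ (λ { (zero , _ , x) → x }) (λ x → 0 , z≤n , x)
  (λ _ → refl) (λ { (zero , z≤n , x) → refl })

Σ≤-suc : ∀ {N} {P : ℕ → Set} → Σ≤ (suc N) P ↔ (Σ≤ N P ⊎ P (suc N))
Σ≤-suc {N} {P} = mk↔ₛ′ split join split∘join join∘split
  where
  split : Σ≤ (suc N) P → Σ≤ N P ⊎ P (suc N)
  split (i , i≤ , x) with i ≟ suc N
  ... | yes refl = inj₂ x
  ... | no i≢    = inj₁ (i , s≤s⁻¹ (≤∧≢⇒< i≤ i≢) , x)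
  join : Σ≤ N P ⊎ P (suc N) → Σ≤ (suc N) P
  join (inj₁ (i , i≤ , x)) = i , m≤n⇒m≤1+n i≤ , x
  join (inj₂ x)            = suc N , ≤-refl , x
  split∘join : ∀ y → split (join y) ≡ y
  split∘join (inj₁ (i , i≤ , x)) with i ≟ suc N
  ... | yes refl = ⊥-elim (1+n≰n i≤)
  ... | no _     = cong (λ p → inj₁ (i , p , x)) (≤-irrelevant _ _)
  split∘join (inj₂ x) with suc N ≟ suc N
  ... | yes refl = refl
  ... | no ≢     = ⊥-elim (≢ refl)
  join∘split : ∀ y → join (split y) ≡ y
  join∘split (i , i≤ , x) with i ≟ suc N
  ... | yes refl = cong (λ p → suc N , p , x) (≤-irrelevant _ _)
  ... | no _     = cong (λ p → i , p , x) (≤-irrelevant _ _)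

Fin-sumTo↔Σ≤ : ∀ N (g : ℕ → ℕ) → Fin (sumTo N g) ↔ Σ≤ N (λ i → Fin (g i))
Fin-sumTo↔Σ≤ zero    g = ↔-sym Σ≤-zero
Fin-sumTo↔Σ≤ (suc N) g =
  Fin (sumTo N g + g (suc N))                  ↔⟨ +↔⊎ ⟩
  (Fin (sumTo N g) ⊎ Fin (g (suc N)))          ↔⟨ Fin-sumTo↔Σ≤ N g ⊎-↔ ↔-refl ⟩
  (Σ≤ N (λ i → Fin (g i)) ⊎ Fin (g (suc N)))   ↔⟨ Σ≤-suc ⟨
  Σ≤ (suc N) (λ i → Fin (g i))                 ∎
  where open EquationalReasoning

Σ≤↔Σ : ∀ {N} {P : ℕ → Set} → (∀ i → P i → i ≤ N) → Σ≤ N P ↔ Σ ℕ P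
Σ≤↔Σ bound = mk↔ₛ′ (λ { (i , _ , x) → i , x }) (λ { (i , x) → i , bound i x , x })
  (λ _ → refl) (λ { (i , _ , x) → cong (λ p → i , p , x) (≤-irrelevant _ _) })

Fin-sumTo↔Σ : ∀ N {g : ℕ → ℕ} {P : ℕ → Set} → (∀ i → Fin (g i) ↔ P i) →
              (∀ i → P i → i ≤ N) → Fin (sumTo N g) ↔ Σ ℕ P
Fin-sumTo↔Σ N {g} {P} Fin-g↔P bound =
  Fin (sumTo N g)          ↔⟨ Fin-sumTo↔Σ≤ N g ⟩
  Σ≤ N (λ i → Fin (g i))   ↔⟨ Σ.congˡ (λ {i} → ↔-refl ×-↔ Fin-g↔P i) ⟩
  Σ≤ N P                   ↔⟨ Σ≤↔Σ bound ⟩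
  Σ ℕ P                    ∎
  where open EquationalReasoning

Σ≤-fibres↔fibre : ∀ {X Y : Set} {s : X → ℕ} {t : Y → ℕ} N →
  Σ≤ N (λ i → Fibre s i × Fibre t (N ∸ i)) ↔ Fibre (λ (xy : X × Y) → s (proj₁ xy) + t (proj₂ xy)) N
Σ≤-fibres↔fibre {s = s} {t} N = mk↔ₛ′ merge split merge∘split split∘merge
  where
  merge : Σ≤ N (λ i → Fibre s i × Fibre t (N ∸ i)) → Fibre _ N
  merge (_ , i≤N , (x , refl) , (y , ty≡)) = (x , y) , trans (cong (s x +_) ty≡) (m+[n∸m]≡n i≤N)
  split : Fibre _ N → Σ≤ N (λ i → Fibre s i × Fibre t (N ∸ i))
  split ((x , y) , e) = s x , subst (s x ≤_) e (m≤m+n (s x) (t y)) , (x , refl) ,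
                        (y , trans (sym (m+n∸m≡n (s x) (t y))) (cong (_∸ s x) e))
  merge∘split : ∀ z → merge (split z) ≡ z
  merge∘split (xy , e) = cong (xy ,_) (≡-irrelevant _ _)
  split∘merge : ∀ z → split (merge z) ≡ z
  split∘merge (_ , _ , (x , refl) , (y , _)) =
    cong₂ (λ p q → s x , p , (x , refl) , (y , q)) (≤-irrelevant _ _) (≡-irrelevant _ _)

Fin1×A↔A : ∀ {n} {A : Set} → n ≡ 1 → (Fin n × A) ↔ A
Fin1×A↔A refl = mk↔ₛ′ proj₂ (zero ,_) (λ _ → refl) (λ { (zero , _) → refl ; (suc () , _) })

Σ×↔×Σ : ∀ {A : Set} {B : ℕ → Set} → Σ ℕ (λ l → A × B l) ↔ (A × Σ ℕ B)
Σ×↔×Σ = mk↔ₛ′ (λ (l , a , b) → a , l , b) (λ (a , l , b) → l , a , b) (λ _ → refl) (λ _ → refl)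

Σℕ↔⊎ : ∀ {P : ℕ → Set} → Σ ℕ P ↔ (P 0 ⊎ Σ ℕ (λ m → P (suc m)))
Σℕ↔⊎ = mk↔ₛ′ (λ { (zero , x) → inj₁ x ; (suc m , x) → inj₂ (m , x) })
  (λ { (inj₁ x) → 0 , x ; (inj₂ (m , x)) → suc m , x })
  (λ { (inj₁ x) → refl ; (inj₂ (m , x)) → refl }) (λ { (zero , x) → refl ; (suc m , x) → refl })

Σ≤-×↔× : ∀ {m} {A : ℕ → Set} {B : Set} → Σ≤ m (λ k → A k × B) ↔ (Σ≤ m A × B)
Σ≤-×↔× = mk↔ₛ′ (λ (k , k≤m , a , b) → (k , k≤m , a) , b) (λ ((k , k≤m , a) , b) → k , k≤m , a , b)
  (λ _ → refl) (λ _ → refl)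

Σ-diagonal↔Σ≤ : ∀ {F : ℕ → ℕ → Set} →
                Σ ℕ (λ n → Σ ℕ (F n)) ↔ Σ ℕ (λ m → Σ≤ m (λ k → F (m ∸ k) k))
Σ-diagonal↔Σ≤ {F} = mk↔ₛ′ to from to∘from from∘to
  where
  to : Σ ℕ (λ n → Σ ℕ (F n)) → Σ ℕ (λ m → Σ≤ m (λ k → F (m ∸ k) k))
  to (n , k , x) = n + k , k , m≤n+m k n , subst (λ d → F d k) (sym (m+n∸n≡m n k)) x
  from : Σ ℕ (λ m → Σ≤ m (λ k → F (m ∸ k) k)) → Σ ℕ (λ n → Σ ℕ (F n))
  from (m , k , _ , x) = m ∸ k , k , x
  from∘to : ∀ y → from (to y) ≡ y
  from∘to (n , k , x) = lemma (m+n∸n≡m n k)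
    where
    lemma : ∀ {d} (e : d ≡ n) → (d , k , subst (λ d → F d k) (sym e) x) ≡ (n , k , x)
    lemma refl = refl
  to∘from : ∀ y → to (from y) ≡ y
  to∘from (m , k , k≤m , x) = lemma (m∸n+n≡m k≤m) (m+n∸n≡m (m ∸ k) k)
    where
    lemma : ∀ {m′} (e : m′ ≡ m) {k≤m′ : k ≤ m′} (e′ : m′ ∸ k ≡ m ∸ k) →
            _≡_ {A = Σ ℕ (λ m → Σ≤ m (λ k → F (m ∸ k) k))}
                (m′ , k , k≤m′ , subst (λ d → F d k) (sym e′) x) (m , k , k≤m , x)
    lemma refl refl = cong (λ p → m , k , p , x) (≤-irrelevant _ _)

Fin-⊛ : ∀ {X Y : Set} {s : X → ℕ} {t : Y → ℕ} {F G : Series} →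
        (∀ i → Fin (F i) ↔ Fibre s i) → (∀ j → Fin (G j) ↔ Fibre t j) →
        ∀ N → Fin ((F ⊛ G) N) ↔ Fibre (λ (xy : X × Y) → s (proj₁ xy) + t (proj₂ xy)) N
Fin-⊛ {s = s} {t} {F} {G} Fin-F Fin-G N =
  Fin (sumTo N (λ i → F i * G (N ∸ i)))      ↔⟨ Fin-sumTo↔Σ≤ N _ ⟩
  Σ≤ N (λ i → Fin (F i * G (N ∸ i)))         ↔⟨ Σ.congˡ (λ {i} → ↔-refl ×-↔ *↔×) ⟩
  Σ≤ N (λ i → Fin (F i) × Fin (G (N ∸ i)))
    ↔⟨ Σ.congˡ (λ {i} → ↔-refl ×-↔ (Fin-F i ×-↔ Fin-G (N ∸ i))) ⟩
  Σ≤ N (λ i → Fibre s i × Fibre t (N ∸ i))   ↔⟨ Σ≤-fibres↔fibre N ⟩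
  Fibre _ N                                  ∎
  where open EquationalReasoning

-- One of the g (1 + hidden) chains of 1 + hidden transitions that a transition labelled g stands for.
record Chain (g : Series) : Set where
  constructor chain
  field
    hidden : ℕ
    copy   : Fin (g (suc hidden))

length : ∀ {g} → Chain g → ℕ
length (chain a _) = suc a

total : ∀ {g j} → Vec (Chain g) j → ℕ
total []      = 0
total (c ∷ v) = length c + total v

count≤total : ∀ {g j} (v : Vec (Chain g) j) → j ≤ total v
count≤total []              = z≤n
count≤total (chain a _ ∷ v) = s≤s (≤-trans (count≤total v) (m≤n+m (total v) a))

Fin-chain : ∀ {g} → ZeroConst g → ∀ n → Fin (g n) ↔ Fibre (length {g}) n
Fin-chain g0≡0 zero    = mk↔ₛ′ (λ x → ⊥-elim (¬Fin0 (subst Fin g0≡0 x))) (λ { (_ , ()) })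
  (λ { (_ , ()) }) (λ x → ⊥-elim (¬Fin0 (subst Fin g0≡0 x)))
Fin-chain g0≡0 (suc a) = mk↔ₛ′ (λ x → chain a x , refl) (λ { (chain _ x , refl) → x })
  (λ { (_ , refl) → refl }) (λ _ → refl)

Fin-one : ∀ {g} n → Fin (one n) ↔ Fibre (total {g} {0}) n
Fin-one zero    = mk↔ₛ′ (λ _ → [] , refl) (λ _ → zero)
  (λ { ([] , refl) → refl }) (λ { zero → refl ; (suc ()) })
Fin-one (suc n) = mk↔ₛ′ (λ ()) (λ { ([] , ()) }) (λ { ([] , ()) }) (λ ())

Chain×Vec↔Vec : ∀ {g j} → (Chain g × Vec (Chain g) j) ↔ Vec (Chain g) (suc j)
Chain×Vec↔Vec = mk↔ₛ′ (λ (c , v) → c ∷ v) (λ { (c ∷ v) → c , v })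
  (λ { (c ∷ v) → refl }) (λ (c , v) → refl)

Fin-pow : ∀ {g} → ZeroConst g → ∀ j n → Fin (pow g j n) ↔ Fibre (total {g} {j}) n
Fin-pow g0≡0 zero    n = Fin-one n
Fin-pow g0≡0 (suc j) n =
  ↔-trans (Fin-⊛ (Fin-chain g0≡0) (Fin-pow g0≡0 j) n) (fibre-↔ Chain×Vec↔Vec (λ _ → refl))

-- Shuffles, subsets and words

data Shuffle : ℕ → ℕ → Set where
  []    : Shuffle 0 0
  left  : Shuffle a b → Shuffle (suc a) b
  right : Shuffle a b → Shuffle a (suc b)

data Choose : ℕ → ℕ → Set where
  []   : Choose 0 0
  take : Choose n k → Choose (suc n) (suc k)
  skip : Choose n k → Choose (suc n) k

Choose-suc-zero : Choose (suc n) 0 ↔ Choose n 0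
Choose-suc-zero = mk↔ₛ′ (λ { (skip c) → c }) skip (λ _ → refl) (λ { (skip c) → refl })

Choose-suc-suc : Choose (suc n) (suc k) ↔ (Choose n k ⊎ Choose n (suc k))
Choose-suc-suc = mk↔ₛ′ (λ { (take c) → inj₁ c ; (skip c) → inj₂ c })
  (λ { (inj₁ c) → take c ; (inj₂ c) → skip c })
  (λ { (inj₁ c) → refl ; (inj₂ c) → refl }) (λ { (take c) → refl ; (skip c) → refl })

Choose↔Fin : ∀ n k → Choose n k ↔ Fin (n C k)
Choose↔Fin zero    zero    = mk↔ₛ′ (λ _ → zero) (λ _ → [])
  (λ { zero → refl ; (suc ()) }) (λ { [] → refl })
Choose↔Fin zero    (suc k) = mk↔ₛ′ (λ ()) (λ ()) (λ ()) (λ ())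
Choose↔Fin (suc n) zero    = ↔-trans Choose-suc-zero (Choose↔Fin n zero)
Choose↔Fin (suc n) (suc k) =
  Choose (suc n) (suc k)            ↔⟨ Choose-suc-suc ⟩
  (Choose n k ⊎ Choose n (suc k))   ↔⟨ Choose↔Fin n k ⊎-↔ Choose↔Fin n (suc k) ⟩
  (Fin (n C k) ⊎ Fin (n C suc k))   ↔⟨ +↔⊎ ⟨
  Fin (n C k + n C suc k)           ≡⟨ cong Fin (nCk+nC[k+1]≡[n+1]C[k+1] n k) ⟩
  Fin (suc n C suc k)               ∎
  where open EquationalReasoning

Shuffle-zero-suc : Shuffle 0 (suc b) ↔ Shuffle 0 b
Shuffle-zero-suc = mk↔ₛ′ (λ { (right s) → s }) right (λ _ → refl) (λ { (right s) → refl })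

Shuffle-suc-zero : Shuffle (suc a) 0 ↔ Shuffle a 0
Shuffle-suc-zero = mk↔ₛ′ (λ { (left s) → s }) left (λ _ → refl) (λ { (left s) → refl })

Shuffle-suc-suc : Shuffle (suc a) (suc b) ↔ (Shuffle a (suc b) ⊎ Shuffle (suc a) b)
Shuffle-suc-suc = mk↔ₛ′ (λ { (left s) → inj₁ s ; (right s) → inj₂ s })
  (λ { (inj₁ s) → left s ; (inj₂ s) → right s })
  (λ { (inj₁ s) → refl ; (inj₂ s) → refl }) (λ { (left s) → refl ; (right s) → refl })

[n+0]Cn≡1 : ∀ n → (n + 0) C n ≡ 1
[n+0]Cn≡1 n = trans (cong (_C n) (+-identityʳ n)) (nCn≡1 n)

Shuffle↔Fin : ∀ a b → Shuffle a b ↔ Fin ((a + b) C a)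
Shuffle↔Fin zero    zero    = mk↔ₛ′ (λ _ → zero) (λ _ → [])
  (λ { zero → refl ; (suc ()) }) (λ { [] → refl })
Shuffle↔Fin zero    (suc b) = ↔-trans Shuffle-zero-suc (Shuffle↔Fin zero b)
Shuffle↔Fin (suc a) zero    = ↔-trans Shuffle-suc-zero (↔-trans (Shuffle↔Fin a zero)
  (K-reflexive (cong Fin (trans ([n+0]Cn≡1 a) (sym ([n+0]Cn≡1 (suc a)))))))
Shuffle↔Fin (suc a) (suc b) =
  Shuffle (suc a) (suc b)                               ↔⟨ Shuffle-suc-suc ⟩
  (Shuffle a (suc b) ⊎ Shuffle (suc a) b)               ↔⟨ Shuffle↔Fin a (suc b) ⊎-↔ Shuffle↔Fin (suc a) b ⟩
  (Fin ((a + suc b) C a) ⊎ Fin (suc (a + b) C suc a))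
    ≡⟨ cong (λ m → Fin ((a + suc b) C a) ⊎ Fin (m C suc a)) (sym (+-suc a b)) ⟩
  (Fin ((a + suc b) C a) ⊎ Fin ((a + suc b) C suc a))   ↔⟨ +↔⊎ ⟨
  Fin ((a + suc b) C a + (a + suc b) C suc a)           ≡⟨ cong Fin (nCk+nC[k+1]≡[n+1]C[k+1] (a + suc b) a) ⟩
  Fin ((suc a + suc b) C suc a)                         ∎
  where open EquationalReasoning

data Word : ℕ → ℕ → ℕ → Set where
  []   : Word 0 0 0
  loop : Word l n a → Word (suc l) n a
  up   : Word l n a → Word l (suc n) (suc a)
  down : Word l n a → Word l (suc n) a

Word↔Shuffle×Choose : Word l n a ↔ (Shuffle l n × Choose n a)
Word↔Shuffle×Choose = mk↔ₛ′ split merge split∘merge merge∘split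
  where
  split : Word l n a → Shuffle l n × Choose n a
  split []       = [] , []
  split (loop w) = let s , c = split w in left s , c
  split (up w)   = let s , c = split w in right s , take c
  split (down w) = let s , c = split w in right s , skip c
  merge : Shuffle l n × Choose n a → Word l n a
  merge ([] , [])          = []
  merge (left s , c)       = loop (merge (s , c))
  merge (right s , take c) = up (merge (s , c))
  merge (right s , skip c) = down (merge (s , c))
  split∘merge : ∀ sc → split {l} {n} {a} (merge sc) ≡ sc
  split∘merge ([] , [])          = refl
  split∘merge (left s , c)       = cong (λ (s , c) → left s , c) (split∘merge (s , c))
  split∘merge (right s , take c) = cong (λ (s , c) → right s , take c) (split∘merge (s , c))
  split∘merge (right s , skip c) = cong (λ (s , c) → right s , skip c) (split∘merge (s , c))
  merge∘split : ∀ w → merge (split {l} {n} {a} w) ≡ w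
  merge∘split []       = refl
  merge∘split (loop w) = cong loop (merge∘split w)
  merge∘split (up w)   = cong up (merge∘split w)
  merge∘split (down w) = cong down (merge∘split w)

Word↔Fin : Word l n a ↔ (Fin (n C a) × Fin ((l + n) C l))
Word↔Fin {l} {n} {a} =
  ↔-trans Word↔Shuffle×Choose (↔-trans (Shuffle↔Fin l n ×-↔ Choose↔Fin n a) (×-comm _ _))

-- The ballot-number identity

module _ where
  open ≡-Reasoning

  [k+1]*[n+1]C[k+1]≡[n+1]*nCk : ∀ n k → suc k * (suc n C suc k) ≡ suc n * (n C k)
  [k+1]*[n+1]C[k+1]≡[n+1]*nCk zero    zero    = refl
  [k+1]*[n+1]C[k+1]≡[n+1]*nCk zero    (suc k) = *-zeroʳ (suc (suc k))
  [k+1]*[n+1]C[k+1]≡[n+1]*nCk (suc n) zero    =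
    trans (*-identityˡ _) (trans (nC1≡n (suc (suc n))) (sym (*-identityʳ _)))
  [k+1]*[n+1]C[k+1]≡[n+1]*nCk (suc n) (suc k) = begin
    suc (suc k) * (suc (suc n) C suc (suc k))
      ≡⟨ cong (suc (suc k) *_) (nCk+nC[k+1]≡[n+1]C[k+1] (suc n) (suc k)) ⟨
    suc (suc k) * (X + suc n C suc (suc k))
      ≡⟨ *-distribˡ-+ (suc (suc k)) X _ ⟩
    suc (suc k) * X + suc (suc k) * (suc n C suc (suc k))
      ≡⟨ cong₂ (λ y z → X + y + z) ([k+1]*[n+1]C[k+1]≡[n+1]*nCk n k) ([k+1]*[n+1]C[k+1]≡[n+1]*nCk n (suc k)) ⟩
    X + suc n * (n C k) + suc n * (n C suc k)
      ≡⟨ distrib X (suc n) (n C k) (n C suc k) ⟩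
    X + suc n * (n C k + n C suc k)
      ≡⟨ cong (λ y → X + suc n * y) (nCk+nC[k+1]≡[n+1]C[k+1] n k) ⟩
    X + suc n * X
      ∎
    where
    X : ℕ
    X = suc n C suc k
    distrib : ∀ x a y z → x + a * y + a * z ≡ x + a * (y + z)
    distrib = solve-∀

  walks : ℕ → ℕ → ℕ
  walks n k = (n + 2 * k) C k

  walks′ : ℕ → ℕ → ℕ
  walks′ n zero    = 0
  walks′ n (suc k) = walks (suc n) k

  -- The ballot number n/(n+2k)·C(n+2k,k), written without division.
  ballot : ℕ → ℕ → ℕ
  ballot n k = walks n k ∸ 2 * walks′ n k

  k*walks≡len*walks′ : ∀ n k → k * walks n k ≡ (n + 2 * k) * walks′ n k
  k*walks≡len*walks′ n zero    = sym (*-zeroʳ (n + 0))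
  k*walks≡len*walks′ n (suc k) = begin
    suc k * ((n + 2 * suc k) C suc k)       ≡⟨ cong (λ m → suc k * (m C suc k)) len≡ ⟩
    suc k * (suc (suc n + 2 * k) C suc k)   ≡⟨ [k+1]*[n+1]C[k+1]≡[n+1]*nCk (suc n + 2 * k) k ⟩
    suc (suc n + 2 * k) * walks (suc n) k   ≡⟨ cong (_* walks (suc n) k) len≡ ⟨
    (n + 2 * suc k) * walks (suc n) k       ∎
    where
    shift : ∀ n k → n + 2 * suc k ≡ suc (suc n + 2 * k)
    shift = solve-∀
    len≡ : n + 2 * suc k ≡ suc (suc n + 2 * k)
    len≡ = shift n k

  len*2walks′≡2k*walks : ∀ n k → (n + 2 * k) * (2 * walks′ n k) ≡ 2 * k * walks n k
  len*2walks′≡2k*walks n k = begin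
    (n + 2 * k) * (2 * walks′ n k)   ≡⟨ swap (n + 2 * k) (walks′ n k) ⟩
    2 * ((n + 2 * k) * walks′ n k)   ≡⟨ cong (2 *_) (k*walks≡len*walks′ n k) ⟨
    2 * (k * walks n k)              ≡⟨ *-assoc 2 k (walks n k) ⟨
    2 * k * walks n k                ∎
    where
    swap : ∀ l y → l * (2 * y) ≡ 2 * (l * y)
    swap = solve-∀

  2walks′≤walks : ∀ n k → 2 * walks′ (suc n) k ≤ walks (suc n) k
  2walks′≤walks n k = *-cancelˡ-≤ (suc n + 2 * k)
    (subst (_≤ (suc n + 2 * k) * walks (suc n) k) (sym (len*2walks′≡2k*walks (suc n) k))
           (*-monoˡ-≤ (walks (suc n) k) (m≤n+m (2 * k) (suc n))))

  len*ballot≡n*walks : ∀ n k → (n + 2 * k) * ballot n k ≡ n * walks n k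
  len*ballot≡n*walks n k = begin
    L * (A ∸ 2 * walks′ n k)        ≡⟨ *-distribˡ-∸ L A (2 * walks′ n k) ⟩
    L * A ∸ L * (2 * walks′ n k)    ≡⟨ cong (L * A ∸_) (len*2walks′≡2k*walks n k) ⟩
    L * A ∸ 2 * k * A               ≡⟨ cong (_∸ 2 * k * A) (*-distribʳ-+ A n (2 * k)) ⟩
    n * A + 2 * k * A ∸ 2 * k * A   ≡⟨ m+n∸n≡m (n * A) (2 * k * A) ⟩
    n * A                           ∎
    where
    L A : ℕ
    L = n + 2 * k
    A = walks n k

  weight≡2^n*ballot : ∀ n k → weight n k ≡ 2 ^ suc n * ballot (suc n) k
  weight≡2^n*ballot n k = cong (2 ^ suc n *_) (begin
    (suc n * walks (suc n) k) / L   ≡⟨ cong (_/ L) (len*ballot≡n*walks (suc n) k) ⟨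
    (L * ballot (suc n) k) / L      ≡⟨ cong (_/ L) (*-comm L (ballot (suc n) k)) ⟩
    (ballot (suc n) k * L) / L      ≡⟨ m*n/n≡m (ballot (suc n) k) L ⟩
    ballot (suc n) k                ∎)
    where
    L : ℕ
    L = suc n + 2 * k

  weight-step : ∀ n j →
    2 ^ suc (suc n) * walks (suc (suc n)) j + weight n (suc j) ≡ 2 ^ suc n * walks (suc n) (suc j)
  weight-step n j = begin
    2 * P * Y + weight n (suc j)   ≡⟨ cong (2 * P * Y +_) (weight≡2^n*ballot n (suc j)) ⟩
    2 * P * Y + P * B              ≡⟨ factor P Y B ⟩
    P * (B + 2 * Y)                ≡⟨ cong (P *_) (m∸n+n≡m (2walks′≤walks n (suc j))) ⟩
    P * walks (suc n) (suc j)      ∎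
    where
    P Y B : ℕ
    P = 2 ^ suc n
    Y = walks (suc (suc n)) j
    B = ballot (suc n) (suc j)
    factor : ∀ p y b → 2 * p * y + p * b ≡ p * (b + 2 * y)
    factor = solve-∀

  weight-partialSum : ∀ m j → j ≤ m →
    sumTo j (λ k → weight (m ∸ k) k) ≡ 2 ^ suc (m ∸ j) * walks (suc (m ∸ j)) j
  weight-partialSum m zero    _   = weight≡2^n*ballot m 0
  weight-partialSum m (suc j) j<m = begin
    sumTo j (λ k → weight (m ∸ k) k) + W
      ≡⟨ cong (_+ W) (weight-partialSum m j (<⇒≤ j<m)) ⟩
    2 ^ suc (m ∸ j) * walks (suc (m ∸ j)) j + W
      ≡⟨ cong (λ d → 2 ^ suc d * walks (suc d) j + W) (+-∸-assoc 1 j<m) ⟩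
    2 ^ suc (suc (m ∸ suc j)) * walks (suc (suc (m ∸ suc j))) j + W
      ≡⟨ weight-step (m ∸ suc j) j ⟩
    2 ^ suc (m ∸ suc j) * walks (suc (m ∸ suc j)) (suc j)
      ∎
    where
    W : ℕ
    W = weight (m ∸ suc j) (suc j)

  sum-weight≡central : ∀ m → sumTo m (λ k → weight (m ∸ k) k) ≡ (suc m + suc m) C suc m
  sum-weight≡central m = begin
    sumTo m (λ k → weight (m ∸ k) k)          ≡⟨ weight-partialSum m m ≤-refl ⟩
    2 ^ suc (m ∸ m) * walks (suc (m ∸ m)) m   ≡⟨ cong (λ d → 2 ^ suc d * walks (suc d) m) (n∸n≡0 m) ⟩
    2 * 1 * (L C m)                           ≡⟨ double (L C m) ⟩
    L C m + L C m                             ≡⟨ cong (L C m +_) symmetry ⟩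
    L C m + L C suc m                         ≡⟨ nCk+nC[k+1]≡[n+1]C[k+1] L m ⟩
    suc L C suc m                             ≡⟨ cong (_C suc m) length≡ ⟩
    (suc m + suc m) C suc m                   ∎
    where
    L : ℕ
    L = 1 + 2 * m
    double : ∀ x → 2 * 1 * x ≡ x + x
    double = solve-∀
    split : ∀ m → 1 + 2 * m ≡ suc m + m
    split = solve-∀
    length≡ : suc L ≡ suc m + suc m
    length≡ = trans (cong suc (split m)) (sym (+-suc (suc m) m))
    symmetry : L C m ≡ L C suc m
    symmetry = begin
      L C m                           ≡⟨ nCk≡nC[n∸k] (subst (m ≤_) (sym (split m)) (m≤n+m m (suc m))) ⟩
      L C (L ∸ m)                     ≡⟨ cong (λ l → l C (l ∸ m)) (split m) ⟩
      (suc m + m) C (suc m + m ∸ m)   ≡⟨ cong ((suc m + m) C_) (m+n∸n≡m (suc m) m) ⟩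
      (suc m + m) C suc m             ≡⟨ cong (_C suc m) (split m) ⟨
      L C suc m                       ∎

-- The coefficients of B_b

module _ (f h : Series) where

  Pairs : ℕ → ℕ → Set
  Pairs j l = Vec (Chain f) j × Vec (Chain h) l

  pairSize : ∀ {j l} → Pairs j l → ℕ
  pairSize (v , w) = total v + total w

  pairs-bound : ∀ {j l N} → Fibre (pairSize {j} {l}) N → j ≤ N × l ≤ N
  pairs-bound ((v , w) , refl) =
    ≤-trans (count≤total v) (m≤m+n _ _) , ≤-trans (count≤total w) (m≤n+m _ _)

  -- m up-steps, m down-steps and l loops, with the chains they are taken as
  Config : ℕ → ℕ → Set
  Config N m = Σ[ l ∈ ℕ ] (Fin ((m + m) C m) × Fin ((l + (m + m)) C l) × Fibre (pairSize {m + m} {l}) N)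

  private
    moves : ℕ → ℕ → ℕ
    moves n k = 2 * suc n + 2 * k

    Term : ℕ → ℕ → ℕ → ℕ → Set
    Term N n k l = Fin (weight n k) × Fin ((l + moves n k) C l) × Fibre (pairSize {moves n k} {l}) N

    Tail : ℕ → ℕ → Set
    Tail N j = Σ[ l ∈ ℕ ] (Fin ((l + j) C l) × Fibre (pairSize {j} {l}) N)

    moves-diagonal : ∀ {m k} → k ≤ m → moves (m ∸ k) k ≡ suc m + suc m
    moves-diagonal {m} {k} k≤m = trans (regroup (m ∸ k) k) (cong (λ s → suc s + suc s) (m∸n+n≡m k≤m))
      where
      regroup : ∀ d k → 2 * suc d + 2 * k ≡ suc (d + k) + suc (d + k)
      regroup = solve-∀

    n≤moves : ∀ n k → n ≤ moves n k
    n≤moves n k = ≤-trans (n≤1+n n) (≤-trans (m≤m+n (suc n) _) (m≤m+n _ (2 * k)))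

    k≤moves : ∀ n k → k ≤ moves n k
    k≤moves n k = ≤-trans (m≤m+n k (k + 0)) (m≤n+m (2 * k) (2 * suc n))

  module _ (f0 : ZeroConst f) (h0 : ZeroConst h) where

    Fin-pairs : ∀ j l N → Fin ((pow f j ⊛ pow h l) N) ↔ Fibre (pairSize {j} {l}) N
    Fin-pairs j l = Fin-⊛ (Fin-pow f0 j) (Fin-pow h0 l)

    Fin-geometric : ∀ N → Fin (geomCoef h N) ↔ Config N 0
    Fin-geometric N = Fin-sumTo↔Σ N pointwise (λ l x → proj₂ (pairs-bound (proj₂ (proj₂ x))))
      where
      []-pair : ∀ {l} → Vec (Chain h) l ↔ Pairs 0 l
      []-pair = mk↔ₛ′ ([] ,_) proj₂ (λ { ([] , w) → refl }) (λ _ → refl)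
      pointwise : ∀ l → Fin (pow h l N) ↔ (Fin 1 × Fin ((l + 0) C l) × Fibre (pairSize {0} {l}) N)
      pointwise l =
        Fin (pow h l N)                                            ↔⟨ Fin-pow h0 l N ⟩
        Fibre (total {h} {l}) N                                    ↔⟨ fibre-↔ []-pair (λ _ → refl) ⟩
        Fibre (pairSize {0} {l}) N                                 ↔⟨ Fin1×A↔A ([n+0]Cn≡1 l) ⟨
        (Fin ((l + 0) C l) × Fibre (pairSize {0} {l}) N)           ↔⟨ Fin1×A↔A refl ⟨
        (Fin 1 × Fin ((l + 0) C l) × Fibre (pairSize {0} {l}) N)   ∎
        where open EquationalReasoning

    Fin-term : ∀ N n k l →
      Fin (weight n k * ((l + 2 * suc n + 2 * k) C l) * (pow f (moves n k) ⊛ pow h l) N) ↔ Term N n k l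
    Fin-term N n k l =
      Fin (weight n k * ((l + 2 * suc n + 2 * k) C l) * (pow f (moves n k) ⊛ pow h l) N)
        ↔⟨ *↔× ⟩
      (Fin (weight n k * ((l + 2 * suc n + 2 * k) C l)) × Fin ((pow f (moves n k) ⊛ pow h l) N))
        ↔⟨ *↔× ×-↔ Fin-pairs (moves n k) l N ⟩
      ((Fin (weight n k) × Fin ((l + 2 * suc n + 2 * k) C l)) × Fibre (pairSize {moves n k} {l}) N)
        ↔⟨ Σ-assoc ⟩
      (Fin (weight n k) × Fin ((l + 2 * suc n + 2 * k) C l) × Fibre (pairSize {moves n k} {l}) N)
        ≡⟨ cong (λ j → Fin (weight n k) × Fin (j C l) × Fibre (pairSize {moves n k} {l}) N)
                (+-assoc l (2 * suc n) (2 * k)) ⟩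
      Term N n k l
        ∎
      where open EquationalReasoning

    Fin-tripleCoef : ∀ N → Fin (tripleCoef f h N) ↔ Σ ℕ (λ n → Σ ℕ (λ k → Σ ℕ (Term N n k)))
    Fin-tripleCoef N = Fin-sumTo↔Σ N (λ n → Fin-sumTo↔Σ N (λ k → Fin-sumTo↔Σ N (Fin-term N n k)
      (λ l (_ , _ , p) → proj₂ (pairs-bound p)))
      (λ k (_ , _ , _ , p) → ≤-trans (k≤moves n k) (proj₁ (pairs-bound p))))
      (λ n (k , _ , _ , _ , p) → ≤-trans (n≤moves n k) (proj₁ (pairs-bound p)))

    Fin-triple : ∀ N → Fin (tripleCoef f h N) ↔ Σ ℕ (λ m → Config N (suc m))
    Fin-triple N =
      Fin (tripleCoef f h N)
        ↔⟨ Fin-tripleCoef N ⟩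
      Σ ℕ (λ n → Σ ℕ (λ k → Σ ℕ (Term N n k)))
        ↔⟨ Σ.congˡ (Σ.congˡ Σ×↔×Σ) ⟩
      Σ ℕ (λ n → Σ ℕ (λ k → Fin (weight n k) × Tail N (moves n k)))
        ↔⟨ Σ-diagonal↔Σ≤ ⟩
      Σ ℕ (λ m → Σ≤ m (λ k → Fin (weight (m ∸ k) k) × Tail N (moves (m ∸ k) k)))
        ↔⟨ Σ.congˡ (Σ.congˡ (Σ.congˡ (λ {k≤m} →
             ↔-refl ×-↔ K-reflexive (cong (Tail N) (moves-diagonal k≤m))))) ⟩
      Σ ℕ (λ m → Σ≤ m (λ k → Fin (weight (m ∸ k) k) × Tail N (suc m + suc m)))
        ↔⟨ Σ.congˡ Σ≤-×↔× ⟩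
      Σ ℕ (λ m → Σ≤ m (λ k → Fin (weight (m ∸ k) k)) × Tail N (suc m + suc m))
        ↔⟨ Σ.congˡ (Fin-sumTo↔Σ≤ _ _ ×-↔ ↔-refl) ⟨
      Σ ℕ (λ m → Fin (sumTo m (λ k → weight (m ∸ k) k)) × Tail N (suc m + suc m))
        ↔⟨ Σ.congˡ (λ {m} →
             K-reflexive (cong (λ c → Fin c × Tail N (suc m + suc m)) (sum-weight≡central m))) ⟩
      Σ ℕ (λ m → Fin ((suc m + suc m) C suc m) × Tail N (suc m + suc m))
        ↔⟨ Σ.congˡ Σ×↔×Σ ⟨
      Σ ℕ (λ m → Config N (suc m))
        ∎
      where open EquationalReasoning

    Fin-Bb : ∀ N → Fin (Bb f h N) ↔ Σ ℕ (Config N)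
    Fin-Bb N =
      Fin (geomCoef h N + tripleCoef f h N)              ↔⟨ +↔⊎ ⟩
      (Fin (geomCoef h N) ⊎ Fin (tripleCoef f h N))      ↔⟨ Fin-geometric N ⊎-↔ Fin-triple N ⟩
      (Config N 0 ⊎ Σ ℕ (λ m → Config N (suc m)))        ↔⟨ Σℕ↔⊎ ⟨
      Σ ℕ (Config N)                                     ∎
      where open EquationalReasoning

-- Expanding chains

toℕ-fromℕ+suc≢ : ∀ {m r} → toℕ (fromℕ m) + suc r ≢ m
toℕ-fromℕ+suc≢ {m} {r} q = m+1+n≢m m (subst (λ x → x + suc r ≡ m) (toℕ-fromℕ m) q)

toℕ-inject₁+0≢ : ∀ {m} (j : Fin m) → toℕ (inject₁ j) + 0 ≢ m
toℕ-inject₁+0≢ j q = <⇒≢ (toℕ<n j) (trans (sym (toℕ-inject₁ j)) (trans (sym (+-identityʳ _)) q))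

toℕ-inject₁+suc : ∀ {m} (j : Fin m) {r} → toℕ (inject₁ j) + suc r ≡ m → toℕ (suc j) + r ≡ m
toℕ-inject₁+suc j {r} q = trans (sym (+-suc (toℕ j) r)) (trans (cong (_+ suc r) (sym (toℕ-inject₁ j))) q)

module _ (f h : Series) where
  open BLin f h

  -- Walks from d to t in the unexpanded automaton, each transition taken as one of its chains.
  data WalkTo (t : ℤ) : ℤ → Set where
    stop : ∀ {d} → d ≡ t → WalkTo t d
    move : ∀ {d} (e : Edge) → src e ≡ d → Chain (lab e) → WalkTo t (tgt e) → WalkTo t d

  size : ∀ {t d} → WalkTo t d → ℕ
  size (stop _)       = 0
  size (move _ _ c w) = length c + size w

  Paths : State → State → Set
  Paths s u = Σ[ k ∈ ℕ ] Path k s u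

  infixr 5 _◅_
  _◅_ : ∀ {s t u} → Step s t → Paths t u → Paths s u
  st ◅ (k , p) = suc k , st ∷ p

  -- r is the number of `next` steps left before the chain exits.
  climb : ∀ {t e m c} r {i} → View i → toℕ i + r ≡ m →
          Paths (main (tgt e)) (main t) → Paths (hid e (suc m) c i) (main t)
  climb {e = e} {m} {c} zero    ‵fromℕ            _ p = exit e m c ◅ p
  climb                 (suc r) ‵fromℕ            q _ = ⊥-elim (toℕ-fromℕ+suc≢ q)
  climb                 zero    (‵inj₁ {i = j} _) q _ = ⊥-elim (toℕ-inject₁+0≢ j q)
  climb {e = e} {m} {c} (suc r) (‵inj₁ {i = j} _) q p =
    next e m c j ◅ climb r (view (suc j)) (toℕ-inject₁+suc j q) p

  climb-length : ∀ {t e m c} r {i} (v : View i) q (p : Paths (main (tgt e)) (main t)) →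
                 proj₁ (climb {t} {e} {m} {c} r v q p) ≡ suc r + proj₁ p
  climb-length zero    ‵fromℕ            _ _ = refl
  climb-length (suc r) ‵fromℕ            q _ = ⊥-elim (toℕ-fromℕ+suc≢ q)
  climb-length zero    (‵inj₁ {i = j} _) q _ = ⊥-elim (toℕ-inject₁+0≢ j q)
  climb-length (suc r) (‵inj₁ {i = j} _) q p = cong suc (climb-length r (view (suc j)) (toℕ-inject₁+suc j q) p)

  expand : ∀ {t d} → WalkTo t d → Paths (main d) (main t)
  expand (stop refl)                       = 0 , []
  expand (move e refl (chain zero x) w)    = direct e x ◅ expand w
  expand (move e refl (chain (suc m) x) w) = enter e m x ◅ climb m (view zero) refl (expand w)

  mutual
    contract : ∀ {k d t} → Path k (main d) (main t) → WalkTo t d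
    contract []                = stop refl
    contract (direct e x ∷ p)  = move e refl (chain 0 x) (contract p)
    contract (enter e m x ∷ p) = move e refl (chain (suc m) x) (contractʰ p)

    contractʰ : ∀ {k t e m c i} → Path k (hid e (suc m) c i) (main t) → WalkTo t (tgt e)
    contractʰ (next _ _ _ _ ∷ p) = contractʰ p
    contractʰ (exit _ _ _ ∷ p)   = contract p

  climb-contract : ∀ {t e m c} r {i} (v : View i) q (p : Paths (main (tgt e)) (main t)) →
                   contractʰ (proj₂ (climb {t} {e} {m} {c} r v q p)) ≡ contract (proj₂ p)
  climb-contract zero    ‵fromℕ            _ _ = refl
  climb-contract (suc r) ‵fromℕ            q _ = ⊥-elim (toℕ-fromℕ+suc≢ q)
  climb-contract zero    (‵inj₁ {i = j} _) q _ = ⊥-elim (toℕ-inject₁+0≢ j q)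
  climb-contract (suc r) (‵inj₁ {i = j} _) q p = climb-contract r (view (suc j)) (toℕ-inject₁+suc j q) p

  contract∘expand : ∀ {t d} (w : WalkTo t d) → contract (proj₂ (expand w)) ≡ w
  contract∘expand (stop refl)                       = refl
  contract∘expand (move e refl (chain zero x) w)    = cong (move e refl (chain 0 x)) (contract∘expand w)
  contract∘expand (move e refl (chain (suc m) x) w) = cong (move e refl (chain (suc m) x))
    (trans (climb-contract m (view zero) refl (expand w)) (contract∘expand w))

  mutual
    expand∘contract : ∀ {k d t} (p : Path k (main d) (main t)) → expand (contract p) ≡ (k , p)
    expand∘contract []                = refl
    expand∘contract (direct e x ∷ p)  = cong (direct e x ◅_) (expand∘contract p)
    expand∘contract (enter e m x ∷ p) = cong (enter e m x ◅_) (climb-expand m refl p)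

    climb-expand : ∀ {k t e m c i} r (q : toℕ i + r ≡ m) (p : Path k (hid e (suc m) c i) (main t)) →
                   climb r (view i) q (expand (contractʰ p)) ≡ (k , p)
    climb-expand zero    q (exit e m c ∷ p) rewrite view-fromℕ m = cong (exit e m c ◅_) (expand∘contract p)
    climb-expand (suc r) q (exit e m c ∷ p)   = ⊥-elim (toℕ-fromℕ+suc≢ q)
    climb-expand zero    q (next e m c j ∷ p) = ⊥-elim (toℕ-inject₁+0≢ j q)
    climb-expand (suc r) q (next e m c j ∷ p) rewrite view-inject₁ j =
      cong (next e m c j ◅_) (climb-expand r (toℕ-inject₁+suc j q) p)

  walk↔paths : ∀ {t d} → WalkTo t d ↔ Paths (main d) (main t)
  walk↔paths = mk↔ₛ′ expand (λ (_ , p) → contract p) (λ (_ , p) → expand∘contract p) contract∘expand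

  expand-length : ∀ {t d} (w : WalkTo t d) → proj₁ (expand w) ≡ size w
  expand-length (stop refl)                       = refl
  expand-length (move e refl (chain zero x) w)    = cong suc (expand-length w)
  expand-length (move e refl (chain (suc m) x) w) =
    cong suc (trans (climb-length m (view zero) refl (expand w)) (cong (suc m +_) (expand-length w)))

-- Walks on ℤ as words

ℤ-irrelevant : {i j : ℤ} (p q : i ≡ j) → p ≡ q
ℤ-irrelevant = Decidable⇒UIP.≡-irrelevant ℤₚ._≟_

lower-raise : ∀ d → (d +ℤ -1ℤ) +ℤ 1ℤ ≡ d
lower-raise = ℤ-solve-∀

raise-lower : ∀ d → (d +ℤ 1ℤ) +ℤ -1ℤ ≡ d
raise-lower = ℤ-solve-∀

module _ (t : ℤ) where

  private
    step : ∀ {u v} c → u ≡ v → u +ℤ c ≡ v +ℤ c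
    step c = cong (_+ℤ c)

    reassoc-up : ∀ d z → d +ℤ ((1ℤ +ℤ z) +ℤ (1ℤ +ℤ z)) ≡ ((d +ℤ 1ℤ) +ℤ (z +ℤ z)) +ℤ 1ℤ
    reassoc-up = ℤ-solve-∀

    reassoc-up⁻ : ∀ d z → (d +ℤ 1ℤ) +ℤ (z +ℤ z) ≡ (d +ℤ ((1ℤ +ℤ z) +ℤ (1ℤ +ℤ z))) +ℤ -1ℤ
    reassoc-up⁻ = ℤ-solve-∀

    reassoc-down : ∀ i x → (i +ℤ 1ℤ) +ℤ x ≡ (i +ℤ x) +ℤ 1ℤ
    reassoc-down = ℤ-solve-∀

    reassoc-down⁻ : ∀ d x → (d +ℤ -1ℤ) +ℤ x ≡ (d +ℤ x) +ℤ -1ℤ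
    reassoc-down⁻ = ℤ-solve-∀

    push : ∀ t y → (t +ℤ y) +ℤ 1ℤ ≡ t +ℤ (1ℤ +ℤ y)
    push = ℤ-solve-∀

    pull : ∀ t y → (t +ℤ (1ℤ +ℤ y)) +ℤ -1ℤ ≡ t +ℤ y
    pull = ℤ-solve-∀

  balance-loop : ∀ {i d} (x y : ℤ) → i ≡ d → i +ℤ x ≡ t +ℤ y → d +ℤ x ≡ t +ℤ y
  balance-loop x y refl b = b

  balance-up : ∀ {i d} (z y : ℤ) → i ≡ d → (i +ℤ 1ℤ) +ℤ (z +ℤ z) ≡ t +ℤ y →
               d +ℤ ((1ℤ +ℤ z) +ℤ (1ℤ +ℤ z)) ≡ t +ℤ (1ℤ +ℤ y)
  balance-up {d = d} z y refl b = trans (reassoc-up d z) (trans (step 1ℤ b) (push t y))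

  balance-up⁻ : ∀ d (z y : ℤ) → d +ℤ ((1ℤ +ℤ z) +ℤ (1ℤ +ℤ z)) ≡ t +ℤ (1ℤ +ℤ y) →
                (d +ℤ 1ℤ) +ℤ (z +ℤ z) ≡ t +ℤ y
  balance-up⁻ d z y b = trans (reassoc-up⁻ d z) (trans (step -1ℤ b) (pull t y))

  balance-down : ∀ {i d} (x y : ℤ) → i +ℤ 1ℤ ≡ d → i +ℤ x ≡ t +ℤ y → d +ℤ x ≡ t +ℤ (1ℤ +ℤ y)
  balance-down {i} x y refl b = trans (reassoc-down i x) (trans (step 1ℤ b) (push t y))

  balance-down⁻ : ∀ d (x y : ℤ) → d +ℤ x ≡ t +ℤ (1ℤ +ℤ y) → (d +ℤ -1ℤ) +ℤ x ≡ t +ℤ y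
  balance-down⁻ d x y b = trans (reassoc-down⁻ d x) (trans (step -1ℤ b) (pull t y))

module _ (f h : Series) where
  open BLin f h

  -- With a up-steps among the n non-loop moves the height changes by a - (n - a).
  data Decomposition (t d : ℤ) : Set where
    decomposition : ∀ {l n a} → d +ℤ ℤ.pos (a + a) ≡ t +ℤ ℤ.pos n →
                    Word l n a → Vec (Chain f) n → Vec (Chain h) l → Decomposition t d

  chainTotal : ∀ {t d} → Decomposition t d → ℕ
  chainTotal (decomposition _ _ fs hs) = total fs + total hs

  module _ {t : ℤ} where

    loopᴰ : ∀ {i d} → i ≡ d → Chain h → Decomposition t i → Decomposition t d
    loopᴰ p c (decomposition {n = n} {a = a} b w fs hs) =
      decomposition (balance-loop t (ℤ.pos (a + a)) (ℤ.pos n) p b) (loop w) fs (c ∷ hs)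

    upᴰ : ∀ {i d} → i ≡ d → Chain f → Decomposition t (i +ℤ 1ℤ) → Decomposition t d
    upᴰ p c (decomposition {n = n} {a = a} b w fs hs) =
      decomposition (balance-up t (ℤ.pos a) (ℤ.pos n) p b) (up w) (c ∷ fs) hs

    downᴰ : ∀ {i d} → i +ℤ 1ℤ ≡ d → Chain f → Decomposition t i → Decomposition t d
    downᴰ {i} p c (decomposition {n = n} {a = a} b w fs hs) =
      decomposition (balance-down t {i} (ℤ.pos (a + a)) (ℤ.pos n) p b) (down w) (c ∷ fs) hs

    decompose : ∀ {d} → WalkTo f h t d → Decomposition t d
    decompose (stop p)              = decomposition (cong (_+ℤ ℤ.pos 0) p) [] [] []
    decompose (move (loop i) p c w) = loopᴰ p c (decompose w)
    decompose (move (up i) p c w)   = upᴰ p c (decompose w)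
    decompose (move (down i) p c w) = downᴰ p c (decompose w)

    assemble : ∀ d {l n a} → d +ℤ ℤ.pos (a + a) ≡ t +ℤ ℤ.pos n →
               Word l n a → Vec (Chain f) n → Vec (Chain h) l → WalkTo f h t d
    assemble d b [] [] [] = stop (trans (sym (ℤₚ.+-identityʳ d)) (trans b (ℤₚ.+-identityʳ t)))
    assemble d b (loop w) fs (c ∷ hs) = move (loop d) refl c (assemble d b w fs hs)
    assemble d {n = suc n} {suc a} b (up w) (c ∷ fs) hs =
      move (up d) refl c (assemble (d +ℤ 1ℤ) (balance-up⁻ t d (ℤ.pos a) (ℤ.pos n) b) w fs hs)
    assemble d {n = suc n} {a} b (down w) (c ∷ fs) hs =
      move (down (d +ℤ -1ℤ)) (lower-raise d) c
           (assemble (d +ℤ -1ℤ) (balance-down⁻ t d (ℤ.pos (a + a)) (ℤ.pos n) b) w fs hs)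

    reassemble : ∀ {d} → Decomposition t d → WalkTo f h t d
    reassemble {d} (decomposition b w fs hs) = assemble d b w fs hs

    assemble-irrelevant : ∀ d {l n a} (b b′ : d +ℤ ℤ.pos (a + a) ≡ t +ℤ ℤ.pos n) (w : Word l n a) fs hs →
                          assemble d b w fs hs ≡ assemble d b′ w fs hs
    assemble-irrelevant d b b′ w fs hs = cong (λ b → assemble d b w fs hs) (ℤ-irrelevant b b′)

    decomposition-irrelevant : ∀ d {l n a} (b b′ : d +ℤ ℤ.pos (a + a) ≡ t +ℤ ℤ.pos n)
                               (w : Word l n a) fs hs →
                               _≡_ {A = Decomposition t d} (decomposition b w fs hs) (decomposition b′ w fs hs)
    decomposition-irrelevant d b b′ w fs hs = cong (λ b → decomposition b w fs hs) (ℤ-irrelevant b b′)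

    move-down-≡ : ∀ {j i l n a} (q : j ≡ i) (p : j +ℤ 1ℤ ≡ i +ℤ 1ℤ) c (w : Word l n a) fs hs
                  (b′ : j +ℤ ℤ.pos (a + a) ≡ t +ℤ ℤ.pos n) (b : i +ℤ ℤ.pos (a + a) ≡ t +ℤ ℤ.pos n) →
                  move (down j) p c (assemble j b′ w fs hs) ≡ move (down i) refl c (assemble i b w fs hs)
    move-down-≡ {i = i} refl p c w fs hs b′ b =
      cong₂ (λ p v → move (down i) p c v) (ℤ-irrelevant p refl) (assemble-irrelevant i b′ b w fs hs)

    reassemble∘decompose : ∀ {d} (v : WalkTo f h t d) → reassemble (decompose v) ≡ v
    reassemble∘decompose (stop p) = cong stop (ℤ-irrelevant _ _)
    reassemble∘decompose (move (loop i) refl c v) =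
      trans (loop-step (decompose v)) (cong (move (loop i) refl c) (reassemble∘decompose v))
      where
      loop-step : ∀ D → reassemble (loopᴰ refl c D) ≡ move (loop i) refl c (reassemble D)
      loop-step (decomposition b w fs hs) = refl
    reassemble∘decompose (move (up i) refl c v) =
      trans (up-step (decompose v)) (cong (move (up i) refl c) (reassemble∘decompose v))
      where
      up-step : ∀ D → reassemble (upᴰ refl c D) ≡ move (up i) refl c (reassemble D)
      up-step (decomposition b w fs hs) = cong (move (up i) refl c) (assemble-irrelevant (i +ℤ 1ℤ) _ b w fs hs)
    reassemble∘decompose (move (down i) refl c v) =
      trans (down-step (decompose v)) (cong (move (down i) refl c) (reassemble∘decompose v))
      where
      down-step : ∀ D → reassemble (downᴰ refl c D) ≡ move (down i) refl c (reassemble D)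
      down-step (decomposition b w fs hs) = move-down-≡ (raise-lower i) _ c w fs hs _ b

    decompose∘assemble : ∀ d {l n a} (b : d +ℤ ℤ.pos (a + a) ≡ t +ℤ ℤ.pos n) (w : Word l n a) fs hs →
                         decompose (assemble d b w fs hs) ≡ decomposition b w fs hs
    decompose∘assemble d b [] [] [] = decomposition-irrelevant d _ b [] [] []
    decompose∘assemble d b (loop w) fs (c ∷ hs) = cong (loopᴰ refl c) (decompose∘assemble d b w fs hs)
    decompose∘assemble d {n = suc n} {suc a} b (up w) (c ∷ fs) hs =
      trans (cong (upᴰ refl c) (decompose∘assemble (d +ℤ 1ℤ) _ w fs hs))
            (decomposition-irrelevant d _ b (up w) (c ∷ fs) hs)
    decompose∘assemble d {n = suc n} {a} b (down w) (c ∷ fs) hs =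
      trans (cong (downᴰ (lower-raise d) c) (decompose∘assemble (d +ℤ -1ℤ) _ w fs hs))
            (decomposition-irrelevant d _ b (down w) (c ∷ fs) hs)

    walk↔decomposition : ∀ {d} → WalkTo f h t d ↔ Decomposition t d
    walk↔decomposition = mk↔ₛ′ decompose reassemble
      (λ { (decomposition b w fs hs) → decompose∘assemble _ b w fs hs }) reassemble∘decompose

    chainTotal-decompose : ∀ {d} (v : WalkTo f h t d) → chainTotal (decompose v) ≡ size f h v
    chainTotal-decompose (stop _) = refl
    chainTotal-decompose (move (loop i) p c v) =
      trans (loop-step (decompose v)) (cong (length c +_) (chainTotal-decompose v))
      where
      loop-step : ∀ D → chainTotal (loopᴰ p c D) ≡ length c + chainTotal D
      loop-step (decomposition _ _ fs hs) = x∙yz≈y∙xz (total fs) (length c) (total hs)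
    chainTotal-decompose (move (up i) p c v) =
      trans (up-step (decompose v)) (cong (length c +_) (chainTotal-decompose v))
      where
      up-step : ∀ D → chainTotal (upᴰ p c D) ≡ length c + chainTotal D
      up-step (decomposition _ _ fs hs) = +-assoc (length c) (total fs) (total hs)
    chainTotal-decompose (move (down i) p c v) =
      trans (down-step (decompose v)) (cong (length c +_) (chainTotal-decompose v))
      where
      down-step : ∀ D → chainTotal (downᴰ p c D) ≡ length c + chainTotal D
      down-step (decomposition _ _ fs hs) = +-assoc (length c) (total fs) (total hs)

module _ (f h : Series) where
  open BLin f h

  Shape : Set
  Shape = Σ[ m ∈ ℕ ] Σ[ l ∈ ℕ ] (Word l (m + m) m × Pairs f h (m + m) l)

  shapeSize : Shape → ℕ
  shapeSize (_ , _ , _ , p) = pairSize f h p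

  closed↔shape : Decomposition f h (ℤ.pos 0) (ℤ.pos 0) ↔ Shape
  closed↔shape = mk↔ₛ′ (λ { (decomposition {l} {a = m} refl w fs hs) → m , l , w , fs , hs })
    (λ (_ , _ , w , fs , hs) → decomposition refl w fs hs)
    (λ _ → refl) (λ { (decomposition refl w fs hs) → refl })

  shapeSize-closed : ∀ D → shapeSize (Inverse.to closed↔shape D) ≡ chainTotal f h D
  shapeSize-closed (decomposition refl _ _ _) = refl

  Fibre-shapeSize↔Σ-Config : ∀ {N} → Fibre shapeSize N ↔ Σ ℕ (Config f h N)
  Fibre-shapeSize↔Σ-Config {N} =
    Fibre shapeSize N
      ↔⟨ mk↔ₛ′ (λ ((m , l , w , p) , e) → m , l , w , p , e) (λ (m , l , w , p , e) → (m , l , w , p) , e)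
               (λ _ → refl) (λ _ → refl) ⟩
    (Σ[ m ∈ ℕ ] Σ[ l ∈ ℕ ] (Word l (m + m) m × Fibre (pairSize f h {m + m} {l}) N))
      ↔⟨ Σ.congˡ (Σ.congˡ (↔-trans (Word↔Fin ×-↔ ↔-refl) Σ-assoc)) ⟩
    Σ ℕ (Config f h N)
      ∎
    where open EquationalReasoning

  Accepted↔Fibre : ∀ {N} → Accepted N ↔ Fibre (proj₁ {B = λ k → Path k (main (ℤ.pos 0)) (main (ℤ.pos 0))}) N
  Accepted↔Fibre {N} = mk↔ₛ′ (λ p → (N , p) , refl) (λ { ((_ , p) , refl) → p })
    (λ { (_ , refl) → refl }) (λ _ → refl)

mainTheorem9 : (f h : Series) → ZeroConst f → ZeroConst h →
    (N : ℕ) → BLin.Accepted f h N ↔ Fin (Bb f h N)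
mainTheorem9 f h f0 h0 N =
  Accepted N                 ↔⟨ Accepted↔Fibre f h ⟩
  Fibre proj₁ N              ↔⟨ fibre-↔ (walk↔paths f h) (expand-length f h) ⟨
  Fibre (size f h) N         ↔⟨ fibre-↔ (walk↔decomposition f h) (chainTotal-decompose f h) ⟩
  Fibre (chainTotal f h) N   ↔⟨ fibre-↔ (closed↔shape f h) (shapeSize-closed f h) ⟩
  Fibre (shapeSize f h) N    ↔⟨ Fibre-shapeSize↔Σ-Config f h ⟩
  Σ ℕ (Config f h N)         ↔⟨ Fin-Bb f h f0 h0 N ⟨
  Fin (Bb f h N)             ∎
  where
  open BLin f h
  open EquationalReasoning
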